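{- In the comparison query model, given a stable matching instance with one-sided uncertainty and a matching $M$ that is stable, there is a $1$-competitive algorithm for verifying that $M$ is stable, and it uses exactly $\sum_{a\in A} |\{b\in B \mid b \prec_a M(a)\}|$ queries.
   Context: Two disjoint sets $A$, $B$ of agents with $|A|=|B|=n$. Each $a\in A$ has a strict total order $\prec_a$ on $B$ and each $b\in B$ has a strict total order $\prec_b$ on $A$; $x\prec_y z$ means that $y$ prefers $x$ to $z$. A matching is a bijection between $A$ and $B$; $M(a)$ and $M(b)$ denote partners. A pair $(a,b)$ with $b\neq M(a)$ is a blocking pair if $a$ prefers $b$ to $M(a)$ and $b$ prefers $a$ to $M(b)$; $M$ is stable if it has no blocking pair. One-sided uncertainty: the orders $\prec_a$ ($a\in A$) are known initially, the orders $\prec_b$ ($b\in B$) are unknown and are learned only via queries. A comparison query $\mathit{prefer}(b,a_1,a_2)$ (with $b\in B$, $a_1,a_2\in A$) returns whichever of $a_1,a_2$ agent $b$ prefers. An algorithm adaptively makes queries until the known information (the $A$-side preferences and the query answers) proves its output correct, i.e., correct for every $B$-side preference profile consistent with that information. It is $\rho$-competitive if on every instance its number of queries is at most $\rho$ times the minimum size of a query set whose answers on that instance suffice to prove a correct output. For the verification problem (given $M$, verify that $M$ is stable), the competitive ratio is measured only on inputs where $M$ is indeed stable; otherwise the algorithm must detect that $M$ is not stable. -}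

module Defs where

open import Level using (0ℓ)
open import Data.Nat using (ℕ; _*_; _≤_)
open import Data.Bool using (Bool; true; false)
open import Data.Fin using (Fin)
open import Data.Fin.Permutation using (Permutation′; _⟨$⟩ʳ_; _⟨$⟩ˡ_)
open import Data.List using (List; []; _∷_; length; filter; map; allFin)
open import Data.Nat.ListAction using (sum)
open import Data.List.Membership.Propositional using (_∈_)
open import Data.Product using (Σ; _×_; _,_; proj₁; proj₂)
open import Relation.Nullary using (¬_)
open import Relation.Binary.Core using (Rel)
open import Relation.Binary.Structures using (IsStrictTotalOrder)
open import Relation.Binary.Definitions using (tri<; tri≈; tri>)
open import Relation.Binary.PropositionalEquality using (_≡_; _≢_)

-- A and B are both represented by Fin n.

-- A strict total order on a set of n agents; x ≺ z means "x is preferred to z".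
record Pref (n : ℕ) : Set₁ where
  field
    _≺_   : Rel (Fin n) 0ℓ
    isSTO : IsStrictTotalOrder _≡_ _≺_
  open IsStrictTotalOrder isSTO public using (compare; _<?_)

Profile : ℕ → Set₁
Profile n = Fin n → Pref n

_≺[_]_ : {n : ℕ} → Fin n → Pref n → Fin n → Set
x ≺[ P ] z = Pref._≺_ P x z

-- a matching is a bijection A → B;  M ⟨$⟩ʳ a = M(a),  M ⟨$⟩ˡ b = M(b)
Matching : ℕ → Set
Matching n = Permutation′ n

Blocking : {n : ℕ} → Profile n → Profile n → Matching n → Fin n → Fin n → Set
Blocking PA PB M a b =
  (b ≢ M ⟨$⟩ʳ a) × (b ≺[ PA a ] (M ⟨$⟩ʳ a)) × (a ≺[ PB b ] (M ⟨$⟩ˡ b))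

Stable : {n : ℕ} → Profile n → Profile n → Matching n → Set
Stable {n} PA PB M = ¬ (Σ (Fin n) λ a → Σ (Fin n) λ b → Blocking PA PB M a b)

-- comparison query prefer(b, a₁, a₂), encoded as (b , a₁ , a₂)
Query : ℕ → Set
Query n = Fin n × Fin n × Fin n

-- answer of prefer(b, a₁, a₂) under B-side profile PB:
-- true iff the answer is a₁ (if a₁ = a₂ the answer is a₁ = a₂)
prefer : {n : ℕ} → Profile n → Query n → Bool
prefer PB (b , a₁ , a₂) with Pref.compare (PB b) a₁ a₂
... | tri< _ _ _ = true
... | tri≈ _ _ _ = true
... | tri> _ _ _ = false

Consistent : {n : ℕ} → Profile n → Profile n → List (Query n) → Set
Consistent Q PB S = ∀ q → q ∈ S → prefer Q q ≡ prefer PB q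

Correct : {n : ℕ} → Bool → Profile n → Profile n → Matching n → Set
Correct true  PA PB M = Stable PA PB M
Correct false PA PB M = ¬ Stable PA PB M

Proves : {n : ℕ} → Profile n → Profile n → Matching n → List (Query n) → Bool → Set₁
Proves {n} PA PB M S o = ∀ (Q : Profile n) → Consistent Q PB S → Correct o PA Q M

Suffices : {n : ℕ} → Profile n → Profile n → Matching n → List (Query n) → Set₁
Suffices PA PB M S = Σ Bool λ o → Proves PA PB M S o

-- adaptive algorithms as decision trees: ask q continues in the first subtree
-- if prefer(q) returns a₁, in the second one otherwise
data Tree (n : ℕ) : Set where
  stop : Bool → Tree n
  ask  : Query n → Tree n → Tree n → Tree n

run : {n : ℕ} → Profile n → Tree n → Bool × List (Query n)
run PB (stop o) = o , []
run PB (ask q t₁ t₂) with prefer PB q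
... | true  = let r = run PB t₁ in proj₁ r , q ∷ proj₂ r
... | false = let r = run PB t₂ in proj₁ r , q ∷ proj₂ r

Algorithm : ℕ → Set₁
Algorithm n = Profile n → Matching n → Tree n

output : {n : ℕ} → Algorithm n → Profile n → Profile n → Matching n → Bool
output alg PA PB M = proj₁ (run PB (alg PA M))

queries : {n : ℕ} → Algorithm n → Profile n → Profile n → Matching n → List (Query n)
queries alg PA PB M = proj₂ (run PB (alg PA M))

ProvablyCorrect : {n : ℕ} → Algorithm n → Set₁
ProvablyCorrect {n} alg = ∀ (PA PB : Profile n) (M : Matching n) →
  Proves PA PB M (queries alg PA PB M) (output alg PA PB M)

-- ρ-competitive, measured on inputs where M is stable:
-- #queries ≤ ρ · (size of any, hence of a minimum, sufficient query set)
Competitive : {n : ℕ} → ℕ → Algorithm n → Set₁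
Competitive {n} ρ alg = ∀ (PA PB : Profile n) (M : Matching n) → Stable PA PB M →
  ∀ (S : List (Query n)) → Suffices PA PB M S →
  length (queries alg PA PB M) ≤ ρ * length S

betterThanPartner : {n : ℕ} → Profile n → Matching n → Fin n → ℕ
betterThanPartner {n} PA M a = length (filter (λ b → Pref._<?_ (PA a) b (M ⟨$⟩ʳ a)) (allFin n))

queryBound : {n : ℕ} → Profile n → Matching n → ℕ
queryBound {n} PA M = sum (map (betterThanPartner PA M) (allFin n))

-- For every pair (a , b) in which a prefers b to M(a), the algorithm asks b whether it prefers a to M(b),
-- stopping at the first yes; on a stable M all these queries are asked.  For the lower bound fix b and a
-- sufficient query set S, and view the pairs of agents compared at b in S as edges of a graph on A.  If an
-- agent a preferring b to M(a) lay outside the component of M(b), the profile in which b ranks everything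
-- outside that component above everything inside would answer S identically while making (a , b) blocking.
-- So that component contains M(b) and all such a, hence at least as many edges at b as there are such a;
-- summing over b (double counting) bounds |S| from below by the number of queries of the algorithm.
module Submission where

open import Defs
open import Level using (Level; 0ℓ)
open import Data.Bool using (Bool; true; false; _∨_; if_then_else_; f<t) renaming (_<_ to _<ᵇ_)
open import Data.Bool.Properties using (∨-zeroʳ; ⇔→≡)
  renaming (<-isStrictTotalOrder to <ᵇ-isStrictTotalOrder; <-irrefl to <ᵇ-irrefl)
open import Data.Fin using (Fin; zero; suc)
open import Data.Fin.Permutation using (_⟨$⟩ʳ_; _⟨$⟩ˡ_; inverseʳ)
open import Data.Fin.Properties using (_≟_)
open import Data.List using (List; []; _∷_; length; filter; map; tabulate; allFin; concatMap)
open import Data.List.Properties using (length-++; length-map; map-tabulate; map-cong)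
open import Data.List.Membership.Propositional using (_∈_; lose)
open import Data.List.Membership.Propositional.Properties
  using (∈-map⁺; ∈-map⁻; ∈-filter⁺; ∈-filter⁻; ∈-concatMap⁺; ∈-concatMap⁻; ∈-allFin)
open import Data.List.Relation.Unary.All as All using (All; []; _∷_; head; tail)
open import Data.List.Relation.Unary.Any using (here; there; satisfied)
open import Data.Nat using (ℕ; zero; suc; _+_; _*_; _≤_; _<_; z≤n; s≤s)
open import Data.Nat.ListAction using (sum)
open import Data.Nat.Properties
  using (+-0-commutativeMonoid; +-mono-≤; +-mono-<-≤; +-mono-≤-<; +-monoˡ-≤; +-monoʳ-≤; +-identityʳ; +-assoc;
         *-identityˡ; ≤-refl; ≤-reflexive; ≤-trans; ≤-pred; n≤1+n; module ≤-Reasoning)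
open import Algebra.Properties.CommutativeMonoid.Sum +-0-commutativeMonoid
  using (sum-syntax; ∑-comm; ∑-distrib-+; sum-cong-≗; sum-replicate-zero)
open import Data.Product using (Σ; ∃-syntax; _×_; _,_; proj₁; proj₂)
open import Data.Product.Relation.Binary.Lex.Strict using (×-Lex; ×-isStrictTotalOrder)
open import Data.Sum using (_⊎_; inj₁; inj₂)
open import Data.Vec.Functional using (updateAt)
open import Data.Vec.Functional.Properties using (updateAt-updates; updateAt-minimal)
open import Function using (_∘_; _on_; _⇔_; mk⇔; Equivalence)
import Function.Properties.Equivalence as ⇔
open import Relation.Binary.Core using (Rel)
open import Relation.Binary.Definitions using (Trichotomous; tri<; tri≈; tri>)
open import Relation.Binary.Structures using (IsStrictTotalOrder)
open import Relation.Binary.PropositionalEquality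
open import Relation.Nullary using (¬_; Dec; yes; no; does)
open import Relation.Nullary.Decidable using (dec-true; dec-false)
open import Relation.Nullary.Negation using (contradiction)
open import Relation.Unary using (Pred; Decidable)

private variable
  n : ℕ
  A B : Set

∑-mono-≤ : {f g : Fin n → ℕ} → (∀ i → f i ≤ g i) → ∑[ i < n ] f i ≤ ∑[ i < n ] g i
∑-mono-≤ {zero}  f≤g = z≤n
∑-mono-≤ {suc n} f≤g = +-mono-≤ (f≤g zero) (∑-mono-≤ (f≤g ∘ suc))

∑-mono-< : {f g : Fin n → ℕ} → (∀ i → f i ≤ g i) → ∀ j → f j < g j →
           ∑[ i < n ] f i < ∑[ i < n ] g i
∑-mono-< f≤g zero    fj<gj = +-mono-<-≤ fj<gj (∑-mono-≤ (f≤g ∘ suc))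
∑-mono-< f≤g (suc j) fj<gj = +-mono-≤-< (f≤g zero) (∑-mono-< (f≤g ∘ suc) j fj<gj)

sum-tabulate : (f : Fin n → ℕ) → sum (tabulate f) ≡ ∑[ i < n ] f i
sum-tabulate {zero}  f = refl
sum-tabulate {suc n} f = cong (f zero +_) (sum-tabulate (f ∘ suc))

sum-map-allFin : (f : Fin n → ℕ) → sum (map f (allFin n)) ≡ ∑[ i < n ] f i
sum-map-allFin {n} f = trans (cong sum (map-tabulate (λ i → i) f)) (sum-tabulate f)

length-concatMap : (f : A → List B) (xs : List A) → length (concatMap f xs) ≡ sum (map (length ∘ f) xs)
length-concatMap f []       = refl
length-concatMap f (x ∷ xs) = trans (length-++ (f x)) (cong (length (f x) +_) (length-concatMap f xs))

Subset : ℕ → Set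
Subset n = Fin n → Bool

infix 4 _⊆_
infixr 6 _∪_

_⊆_ : Subset n → Subset n → Set
X ⊆ Y = ∀ {x} → X x ≡ true → Y x ≡ true

_∪_ : Subset n → Subset n → Subset n
(X ∪ Y) x = X x ∨ Y x

⁅_⁆ : Fin n → Subset n
⁅ v ⁆ x = does (v ≟ x)

p⊆p∪q : (X Y : Subset n) → X ⊆ X ∪ Y
p⊆p∪q X Y x∈X rewrite x∈X = refl

q⊆p∪q : (X Y : Subset n) → Y ⊆ X ∪ Y
q⊆p∪q X Y {x} x∈Y rewrite x∈Y = ∨-zeroʳ (X x)

x∈p∪q⁻ : (X Y : Subset n) {x : Fin n} → (X ∪ Y) x ≡ true → X x ≡ true ⊎ Y x ≡ true
x∈p∪q⁻ X Y {x} x∈X∪Y with X x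
... | true  = inj₁ refl
... | false = inj₂ x∈X∪Y

x∈⁅x⁆ : (x : Fin n) → ⁅ x ⁆ x ≡ true
x∈⁅x⁆ x = dec-true (x ≟ x) refl

x∈⁅y⁆⇒x≡y : {x : Fin n} (y : Fin n) → ⁅ y ⁆ x ≡ true → x ≡ y
x∈⁅y⁆⇒x≡y {x = x} y x∈y with y ≟ x
... | yes y≡x = sym y≡x

indicator : Bool → ℕ
indicator b = if b then 1 else 0

∣_∣ : Subset n → ℕ
∣_∣ {n} X = ∑[ x < n ] indicator (X x)

indicator-mono : ∀ {a b} → (a ≡ true → b ≡ true) → indicator a ≤ indicator b
indicator-mono {false}         _   = z≤n
indicator-mono {true}  {b} a⇒b rewrite a⇒b refl = ≤-refl

indicator-∨ : ∀ a b → indicator (a ∨ b) ≤ indicator a + indicator b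
indicator-∨ false b = ≤-refl
indicator-∨ true  b = s≤s z≤n

p⊆q⇒x∉p⇒x∈q⇒∣p∣<∣q∣ : {X Y : Subset n} → X ⊆ Y → ∀ x → X x ≡ false → Y x ≡ true → ∣ X ∣ < ∣ Y ∣
p⊆q⇒x∉p⇒x∈q⇒∣p∣<∣q∣ {X = X} {Y} X⊆Y x x∉X x∈Y =
  ∑-mono-< (λ x → indicator-mono (X⊆Y {x})) x (subst₂ (λ a b → indicator a < indicator b) (sym x∉X) (sym x∈Y) ≤-refl)

∣p∪q∣≤∣p∣+∣q∣ : (X Y : Subset n) → ∣ X ∪ Y ∣ ≤ ∣ X ∣ + ∣ Y ∣
∣p∪q∣≤∣p∣+∣q∣ X Y = ≤-trans (∑-mono-≤ (λ x → indicator-∨ (X x) (Y x)))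
                             (≤-reflexive (∑-distrib-+ (indicator ∘ X) (indicator ∘ Y)))

∣⁅x⁆∣≡1 : (x : Fin n) → ∣ ⁅ x ⁆ ∣ ≡ 1
∣⁅x⁆∣≡1 {suc n} zero    = cong suc (sum-replicate-zero n)
∣⁅x⁆∣≡1 {suc n} (suc x) = ∣⁅x⁆∣≡1 x

length-filter-∷ : {P : Pred A 0ℓ} (P? : Decidable P) (x : A) (xs : List A) →
  length (filter P? (x ∷ xs)) ≡ indicator (does (P? x)) + length (filter P? xs)
length-filter-∷ P? x xs with does (P? x)
... | true  = refl
... | false = refl

length-filter-tabulate : {P : Pred A 0ℓ} (P? : Decidable P) (f : Fin n → A) →
  length (filter P? (tabulate f)) ≡ ∑[ i < n ] indicator (does (P? (f i)))
length-filter-tabulate {n = zero}  P? f = refl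
length-filter-tabulate {n = suc n} P? f =
  trans (length-filter-∷ P? (f zero) (tabulate (f ∘ suc))) (cong (_ +_) (length-filter-tabulate P? (f ∘ suc)))

∑-length-filter-key : (key : A → Fin n) (xs : List A) →
  ∑[ k < n ] length (filter (λ x → key x ≟ k) xs) ≡ length xs
∑-length-filter-key {n = n} key [] = sum-replicate-zero n
∑-length-filter-key {n = n} key (x ∷ xs) = begin
  ∑[ k < n ] length (filter (λ y → key y ≟ k) (x ∷ xs))
    ≡⟨ sum-cong-≗ (λ k → length-filter-∷ (λ y → key y ≟ k) x xs) ⟩
  ∑[ k < n ] (indicator (⁅ key x ⁆ k) + length (filter (λ y → key y ≟ k) xs))
    ≡⟨ ∑-distrib-+ (indicator ∘ ⁅ key x ⁆) _ ⟩
  ∣ ⁅ key x ⁆ ∣ + ∑[ k < n ] length (filter (λ y → key y ≟ k) xs)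
    ≡⟨ cong₂ _+_ (∣⁅x⁆∣≡1 (key x)) (∑-length-filter-key key xs) ⟩
  suc (length xs) ∎
  where open ≡-Reasoning

Closed : List (Fin n × Fin n) → Subset n → Set
Closed E Y = All (λ { (x , y) → Y x ≡ Y y }) E

-- The union of the connected components meeting X in the graph on Fin n with edge list E.
record Closure (E : List (Fin n × Fin n)) (X : Subset n) : Set where
  field
    set    : Subset n
    ⊇X     : X ⊆ set
    closed : Closed E set
    size   : ∣ set ∣ ≤ ∣ X ∣ + length E
    least  : ∀ {Z} → X ⊆ Z → Closed E Z → set ⊆ Z

module _ {E : List (Fin n × Fin n)} {X : Subset n} {u v : Fin n} where

  Closure-keep : (C : Closure E X) → Closure.set C u ≡ Closure.set C v → Closure ((u , v) ∷ E) X
  Closure-keep C Cu≡Cv = record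
    { set = set ; ⊇X = ⊇X ; closed = Cu≡Cv ∷ closed
    ; size = ≤-trans size (+-monoʳ-≤ ∣ X ∣ (n≤1+n (length E)))
    ; least = λ { X⊆Z (_ ∷ Z-closed) → least X⊆Z Z-closed } }
    where open Closure C

  -- The edge (u , v) joins the component of X to that of v.
  Closure-merge : (C : Closure E X) → Closure.set C u ≡ true → Closure E (X ∪ ⁅ v ⁆) →
                  Closure ((u , v) ∷ E) X
  Closure-merge C u∈C D = record
    { set = D.set ; ⊇X = X⊆D ; closed = trans (C⊆D u∈C) (sym v∈D) ∷ D.closed
    ; size = ≤-trans D.size (≤-trans (+-monoˡ-≤ (length E) (∣p∪q∣≤∣p∣+∣q∣ X ⁅ v ⁆)) (≤-reflexive
                ( trans (cong (λ k → ∣ X ∣ + k + length E) (∣⁅x⁆∣≡1 v)) (+-assoc ∣ X ∣ 1 (length E)))))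
    ; least = λ { {Z} X⊆Z (Zu≡Zv ∷ Z-closed) → D.least (X∪v⊆Z X⊆Z (trans (sym Zu≡Zv) (C.least X⊆Z Z-closed u∈C))) Z-closed } }
    where
    module C = Closure C
    module D = Closure D
    X∪v⊆Z : ∀ {Z} → X ⊆ Z → Z v ≡ true → (X ∪ ⁅ v ⁆) ⊆ Z
    X∪v⊆Z {Z} X⊆Z v∈Z x∈X∪v with x∈p∪q⁻ X ⁅ v ⁆ x∈X∪v
    ... | inj₁ x∈X = X⊆Z x∈X
    ... | inj₂ x∈v = subst (λ y → Z y ≡ true) (sym (x∈⁅y⁆⇒x≡y v x∈v)) v∈Z
    X⊆D : X ⊆ D.set
    X⊆D x∈X = D.⊇X (p⊆p∪q X ⁅ v ⁆ x∈X)
    C⊆D : C.set ⊆ D.set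
    C⊆D = C.least X⊆D D.closed
    v∈D : D.set v ≡ true
    v∈D = D.⊇X (q⊆p∪q X ⁅ v ⁆ (x∈⁅x⁆ v))
    least : ∀ {Z} → X ⊆ Z → Closed ((u , v) ∷ E) Z → D.set ⊆ Z
    least X⊆Z (Zu≡Zv ∷ Z-closed) = D.least (X∪v⊆Z X⊆Z (trans (sym Zu≡Zv) (C.least X⊆Z Z-closed u∈C))) Z-closed

  Closure-flip : Closure ((v , u) ∷ E) X → Closure ((u , v) ∷ E) X
  Closure-flip C = record
    { set = set ; ⊇X = ⊇X ; closed = sym (head closed) ∷ tail closed ; size = size
    ; least = λ { X⊆Z (Zu≡Zv ∷ Z-closed) → least X⊆Z (sym Zu≡Zv ∷ Z-closed) } }
    where open Closure C

closure : (E : List (Fin n × Fin n)) (X : Subset n) → Closure E X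
closure [] X = record
  { set = X ; ⊇X = λ x∈X → x∈X ; closed = [] ; size = ≤-reflexive (sym (+-identityʳ _))
  ; least = λ X⊆Z _ → X⊆Z }
closure ((u , v) ∷ E) X with closure E X
... | C with Closure.set C u in eu | Closure.set C v in ev
...   | true  | true  = Closure-keep C (trans eu (sym ev))
...   | false | false = Closure-keep C (trans eu (sym ev))
...   | true  | false = Closure-merge C eu (closure E (X ∪ ⁅ v ⁆))
...   | false | true  = Closure-flip (Closure-merge C ev (closure E (X ∪ ⁅ u ⁆)))

module _ {a b ℓ₁ ℓ₂ : Level} {A : Set a} {B : Set b} {_≈_ : Rel B ℓ₁} {_<_ : Rel B ℓ₂} where

  injective-isStrictTotalOrder : (f : A → B) → (∀ {x y} → f x ≈ f y → x ≡ y) →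
    IsStrictTotalOrder _≈_ _<_ → IsStrictTotalOrder _≡_ (_<_ on f)
  injective-isStrictTotalOrder f f-injective sto = record
    { isStrictPartialOrder = record
      { isEquivalence = isEquivalence
      ; irrefl        = λ { refl → S.irrefl S.Eq.refl }
      ; trans         = S.trans
      ; <-resp-≈      = resp₂ (_<_ on f)
      }
    ; compare = compare′
    }
    where
    module S = IsStrictTotalOrder sto
    compare′ : Trichotomous _≡_ (_<_ on f)
    compare′ x y with S.compare (f x) (f y)
    ... | tri< x<y x≉y x≯y = tri< x<y (λ { refl → x≉y S.Eq.refl }) x≯y
    ... | tri≈ x≮y x≈y x≯y = tri≈ x≮y (f-injective x≈y) x≯y
    ... | tri> x≮y x≉y x>y = tri> x≮y (λ { refl → x≉y S.Eq.refl }) x>y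

≺-irrefl : (P : Pref n) {x y : Fin n} → x ≡ y → ¬ (x ≺[ P ] y)
≺-irrefl P = IsStrictTotalOrder.irrefl (Pref.isSTO P)

≺-asym : (P : Pref n) {x y : Fin n} → x ≺[ P ] y → ¬ (y ≺[ P ] x)
≺-asym P = IsStrictTotalOrder.asym (Pref.isSTO P)

≺-cong : {P Q : Pref n} → P ≡ Q → {x y : Fin n} → x ≺[ P ] y ⇔ x ≺[ Q ] y
≺-cong refl = ⇔.refl

module _ (P : Profile n) (c x y : Fin n) where

  prefer-false⇔ : prefer P (c , x , y) ≡ false ⇔ y ≺[ P c ] x
  prefer-false⇔ = mk⇔ to from
    where
    to : prefer P (c , x , y) ≡ false → y ≺[ P c ] x
    to answer with Pref.compare (P c) x y
    ... | tri> _ _ y≺x = y≺x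
    from : y ≺[ P c ] x → prefer P (c , x , y) ≡ false
    from y≺x with Pref.compare (P c) x y
    ... | tri< x≺y _ _ = contradiction y≺x (≺-asym (P c) x≺y)
    ... | tri≈ _ x≡y _ = contradiction y≺x (≺-irrefl (P c) (sym x≡y))
    ... | tri> _ _ _   = refl

  prefer-true⇒ : prefer P (c , x , y) ≡ true → x ≡ y ⊎ x ≺[ P c ] y
  prefer-true⇒ answer with Pref.compare (P c) x y
  ... | tri< x≺y _ _ = inj₂ x≺y
  ... | tri≈ _ x≡y _ = inj₁ x≡y

prefer-cong : (P Q : Profile n) {c x y : Fin n} →
  y ≺[ P c ] x ⇔ y ≺[ Q c ] x → prefer P (c , x , y) ≡ prefer Q (c , x , y)
prefer-cong P Q {c} {x} {y} P⇔Q =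
  ⇔→≡ (⇔.trans (prefer-false⇔ P c x y) (⇔.trans P⇔Q (⇔.sym (prefer-false⇔ Q c x y))))

-- Every agent outside Y is preferred to every agent of Y; otherwise P decides.
demote : Pref n → Subset n → Pref n
demote P Y = record
  { _≺_   = ×-Lex _≡_ _<ᵇ_ (Pref._≺_ P) on rank
  ; isSTO = injective-isStrictTotalOrder rank proj₂
              (×-isStrictTotalOrder <ᵇ-isStrictTotalOrder (Pref.isSTO P))
  }
  where
  rank : Fin _ → Bool × Fin _
  rank x = Y x , x

demote-≺ : (P : Pref n) (Y : Subset n) {x y : Fin n} → Y x ≡ false → Y y ≡ true → x ≺[ demote P Y ] y
demote-≺ P Y x∉Y y∈Y = inj₁ (subst₂ _<ᵇ_ (sym x∉Y) (sym y∈Y) f<t)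

demote-≺-tie : (P : Pref n) (Y : Subset n) {x y : Fin n} → Y x ≡ Y y → x ≺[ demote P Y ] y ⇔ x ≺[ P ] y
demote-≺-tie P Y Yx≡Yy = mk⇔ (λ { (inj₁ Yx<Yy) → contradiction Yx<Yy (<ᵇ-irrefl Yx≡Yy) ; (inj₂ (_ , x≺y)) → x≺y })
                             (λ x≺y → inj₂ (Yx≡Yy , x≺y))

queryEdges : Fin n → List (Query n) → List (Fin n × Fin n)
queryEdges b S = map proj₂ (filter (λ q → proj₁ q ≟ b) S)

∈-queryEdges : {b x y : Fin n} {S : List (Query n)} → (b , x , y) ∈ S → (x , y) ∈ queryEdges b S
∈-queryEdges q∈S = ∈-map⁺ proj₂ (∈-filter⁺ (λ q → proj₁ q ≟ _) q∈S refl)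

∑-length-queryEdges : (S : List (Query n)) → ∑[ b < n ] length (queryEdges b S) ≡ length S
∑-length-queryEdges S =
  trans (sum-cong-≗ (λ b → length-map proj₂ (filter (λ q → proj₁ q ≟ b) S))) (∑-length-filter-key proj₁ S)

adversary : Profile n → Fin n → Subset n → Profile n
adversary PB b Y = updateAt PB b (λ P → demote P Y)

adversary-≺ : (PB : Profile n) (b : Fin n) (Y : Subset n) {x y : Fin n} →
  Y x ≡ false → Y y ≡ true → x ≺[ adversary PB b Y b ] y
adversary-≺ PB b Y x∉Y y∈Y = Equivalence.from (≺-cong (updateAt-updates b PB)) (demote-≺ (PB b) Y x∉Y y∈Y)

-- Every comparison made at b has both ends in Y or both outside, where demote agrees with PB.
adversary-consistent : (PB : Profile n) (b : Fin n) {Y : Subset n} (S : List (Query n)) →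
  Closed (queryEdges b S) Y → Consistent (adversary PB b Y) PB S
adversary-consistent PB b {Y} S Y-closed (c , x , y) q∈S with c ≟ b
... | yes refl = prefer-cong (adversary PB b Y) PB
      (⇔.trans (≺-cong (updateAt-updates b PB))
               (demote-≺-tie (PB b) Y (sym (All.lookup Y-closed (∈-queryEdges q∈S)))))
... | no c≢b   = prefer-cong (adversary PB b Y) PB (≺-cong (updateAt-minimal c b PB c≢b))

does-true⇒ : {P : Set} (P? : Dec P) → does P? ≡ true → P
does-true⇒ (yes p) _ = p

module Verification (PA : Profile n) (M : Matching n) where

  Candidate : Fin n × Fin n → Set
  Candidate (a , b) = b ≺[ PA a ] (M ⟨$⟩ʳ a)

  candidate? : ∀ a b → Dec (Candidate (a , b))
  candidate? a b = Pref._<?_ (PA a) b (M ⟨$⟩ʳ a)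

  candidates : List (Fin n × Fin n)
  candidates = concatMap (λ a → map (a ,_) (filter (candidate? a) (allFin n))) (allFin n)

  candidates-sound : ∀ {p} → p ∈ candidates → Candidate p
  candidates-sound p∈ with satisfied (∈-concatMap⁻ _ {xs = allFin n} p∈)
  ... | a , p∈row with ∈-map⁻ (a ,_) p∈row
  ...   | b , b∈ , refl = proj₂ (∈-filter⁻ (candidate? a) {xs = allFin n} b∈)

  candidates-complete : ∀ {p} → Candidate p → p ∈ candidates
  candidates-complete {a , b} cand =
    ∈-concatMap⁺ _ (lose (∈-allFin a) (∈-map⁺ (a ,_) (∈-filter⁺ (candidate? a) (∈-allFin b) cand)))

  length-candidates : length candidates ≡ queryBound PA M
  length-candidates = trans (length-concatMap _ (allFin n))
    (cong sum (map-cong (λ a → length-map (a ,_) (filter (candidate? a) (allFin n))) (allFin n)))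

  probe : Fin n × Fin n → Query n
  probe (a , b) = b , a , M ⟨$⟩ˡ b

  checkAll : List (Fin n × Fin n) → Tree n
  checkAll []      = stop true
  checkAll (p ∷ ps) = ask (probe p) (stop false) (checkAll ps)

  candidate-blocking : (Q : Profile n) {a b : Fin n} → Candidate (a , b) → a ≺[ Q b ] (M ⟨$⟩ˡ b) →
                       Blocking PA Q M a b
  candidate-blocking Q {a} cand a≺Mb = (λ b≡Ma → ≺-irrefl (PA a) b≡Ma cand) , cand , a≺Mb

  partner-not-candidate : ∀ b → ¬ Candidate (M ⟨$⟩ˡ b , b)
  partner-not-candidate b = ≺-irrefl (PA (M ⟨$⟩ˡ b)) (sym (inverseʳ M))

  probe-true⇒blocking : (Q : Profile n) {a b : Fin n} → Candidate (a , b) →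
                        prefer Q (probe (a , b)) ≡ true → Blocking PA Q M a b
  probe-true⇒blocking Q {a} {b} cand answer with prefer-true⇒ Q b a (M ⟨$⟩ˡ b) answer
  ... | inj₁ refl = contradiction cand (partner-not-candidate b)
  ... | inj₂ a≺Mb = candidate-blocking Q cand a≺Mb

  blocking⇒probe-true : (Q : Profile n) {a b : Fin n} → Blocking PA Q M a b → prefer Q (probe (a , b)) ≡ true
  blocking⇒probe-true Q {a} {b} (_ , _ , a≺Mb) with prefer Q (probe (a , b)) in answer
  ... | true  = refl
  ... | false = contradiction (Equivalence.to (prefer-false⇔ Q b a (M ⟨$⟩ˡ b)) answer) (≺-asym (Q b) a≺Mb)

  stable⇒probe-false : (PB : Profile n) → Stable PA PB M → ∀ {p} → Candidate p → prefer PB (probe p) ≡ false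
  stable⇒probe-false PB stable {a , b} cand with prefer PB (probe (a , b)) in answer
  ... | true  = contradiction (a , b , probe-true⇒blocking PB cand answer) stable
  ... | false = refl

  module _ (PB : Profile n) where

    run-checkAll-false : ∀ ps → proj₁ (run PB (checkAll ps)) ≡ false →
      ∃[ p ] p ∈ ps × probe p ∈ proj₂ (run PB (checkAll ps)) × prefer PB (probe p) ≡ true
    run-checkAll-false (p ∷ ps) rejected with prefer PB (probe p) in answer
    ... | true  = p , here refl , here refl , answer
    ... | false with run-checkAll-false ps rejected
    ...   | p′ , p′∈ps , asked , answer′ = p′ , there p′∈ps , there asked , answer′

    run-checkAll-true : ∀ ps → proj₁ (run PB (checkAll ps)) ≡ true →
      ∀ {p} → p ∈ ps → probe p ∈ proj₂ (run PB (checkAll ps)) × prefer PB (probe p) ≡ false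
    run-checkAll-true (p ∷ ps) accepted p′∈ with prefer PB (probe p) in answer
    run-checkAll-true (p ∷ ps) accepted (here refl)  | false = here refl , answer
    run-checkAll-true (p ∷ ps) accepted (there p′∈) | false =
      let asked , answer′ = run-checkAll-true ps accepted p′∈ in there asked , answer′

    length-run-checkAll : ∀ ps → (∀ {p} → p ∈ ps → prefer PB (probe p) ≡ false) →
      length (proj₂ (run PB (checkAll ps))) ≡ length ps
    length-run-checkAll []       _        = refl
    length-run-checkAll (p ∷ ps) all-false with prefer PB (probe p) | all-false (here refl)
    ... | false | refl = cong suc (length-run-checkAll ps (all-false ∘ there))

    checkAll-candidates-proves :
      Proves PA PB M (proj₂ (run PB (checkAll candidates))) (proj₁ (run PB (checkAll candidates)))
    checkAll-candidates-proves with proj₁ (run PB (checkAll candidates)) in verdict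
    ... | false = λ Q consistent stable →
      let p , p∈ , asked , answer = run-checkAll-false candidates verdict
      in stable (_ , _ , probe-true⇒blocking Q (candidates-sound p∈) (trans (consistent _ asked) answer))
    ... | true  = λ Q consistent (a , b , blocking) →
      let asked , answer = run-checkAll-true candidates verdict (candidates-complete (proj₁ (proj₂ blocking)))
      in contradiction (trans (sym (blocking⇒probe-true Q blocking)) (trans (consistent _ asked) answer)) λ ()

    length-checkAll-candidates : Stable PA PB M → length (proj₂ (run PB (checkAll candidates))) ≡ queryBound PA M
    length-checkAll-candidates stable =
      trans (length-run-checkAll candidates (stable⇒probe-false PB stable ∘ candidates-sound)) length-candidates

  admirers : Fin n → Subset n
  admirers b a = does (candidate? a b)

  queryBound≡∑∣admirers∣ : queryBound PA M ≡ ∑[ b < n ] ∣ admirers b ∣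
  queryBound≡∑∣admirers∣ = begin
    queryBound PA M                                         ≡⟨ sum-map-allFin (betterThanPartner PA M) ⟩
    ∑[ a < n ] betterThanPartner PA M a                     ≡⟨ sum-cong-≗ (λ a → length-filter-tabulate (candidate? a) (λ b → b)) ⟩
    ∑[ a < n ] ∑[ b < n ] indicator (admirers b a)          ≡⟨ ∑-comm (λ a b → indicator (admirers b a)) ⟩
    ∑[ b < n ] ∣ admirers b ∣                               ∎
    where open ≡-Reasoning

  module _ (PB : Profile n) (S : List (Query n)) (proves : Proves PA PB M S true) where

    component : (b : Fin n) → Closure (queryEdges b S) ⁅ M ⟨$⟩ˡ b ⁆
    component b = closure (queryEdges b S) ⁅ M ⟨$⟩ˡ b ⁆

    -- Otherwise b could rank a above M(b) without contradicting any answer in S.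
    admirers⊆component : ∀ b → admirers b ⊆ Closure.set (component b)
    admirers⊆component b {a} a∈admirers with Closure.set (component b) a in a∉C
    ... | true  = refl
    ... | false = contradiction (a , b , candidate-blocking Q cand (adversary-≺ PB b C.set a∉C Mb∈C))
                                (proves Q (adversary-consistent PB b S C.closed))
      where
      module C = Closure (component b)
      Q    = adversary PB b C.set
      cand = does-true⇒ (candidate? a b) a∈admirers
      Mb∈C = C.⊇X (x∈⁅x⁆ (M ⟨$⟩ˡ b))

    ∣admirers∣≤comparisons : ∀ b → ∣ admirers b ∣ ≤ length (queryEdges b S)
    ∣admirers∣≤comparisons b = ≤-pred (begin-strict
      ∣ admirers b ∣                       <⟨ p⊆q⇒x∉p⇒x∈q⇒∣p∣<∣q∣ (admirers⊆component b) (M ⟨$⟩ˡ b) Mb∉admirers Mb∈C ⟩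
      ∣ C.set ∣                            ≤⟨ C.size ⟩
      ∣ ⁅ M ⟨$⟩ˡ b ⁆ ∣ + length (queryEdges b S) ≡⟨ cong (_+ length (queryEdges b S)) (∣⁅x⁆∣≡1 (M ⟨$⟩ˡ b)) ⟩
      suc (length (queryEdges b S))        ∎)
      where
      open ≤-Reasoning
      module C = Closure (component b)
      Mb∉admirers = dec-false (candidate? (M ⟨$⟩ˡ b) b) (partner-not-candidate b)
      Mb∈C        = C.⊇X (x∈⁅x⁆ (M ⟨$⟩ˡ b))

    queryBound≤length : queryBound PA M ≤ length S
    queryBound≤length = begin
      queryBound PA M                         ≡⟨ queryBound≡∑∣admirers∣ ⟩
      ∑[ b < n ] ∣ admirers b ∣               ≤⟨ ∑-mono-≤ ∣admirers∣≤comparisons ⟩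
      ∑[ b < n ] length (queryEdges b S)      ≡⟨ ∑-length-queryEdges S ⟩
      length S                                ∎
      where open ≤-Reasoning

verify : Algorithm n
verify PA M = Verification.checkAll PA M (Verification.candidates PA M)

sufficient⇒proves-stable : {PA PB : Profile n} {M : Matching n} {S : List (Query n)} →
  Stable PA PB M → Suffices PA PB M S → Proves PA PB M S true
sufficient⇒proves-stable stable (true  , proves) = proves
sufficient⇒proves-stable stable (false , proves) = contradiction stable (proves _ (λ _ _ → refl))

verify-competitive : Competitive 1 (verify {n})
verify-competitive PA PB M stable S sufficient = begin
  length (queries verify PA PB M) ≡⟨ length-checkAll-candidates PB stable ⟩
  queryBound PA M                 ≤⟨ queryBound≤length PB S (sufficient⇒proves-stable stable sufficient) ⟩
  length S                        ≡⟨ sym (*-identityˡ (length S)) ⟩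
  1 * length S                    ∎
  where
  open ≤-Reasoning
  open Verification PA M

theorem4 : (n : ℕ) → Σ (Algorithm n) λ alg →
    ProvablyCorrect alg × Competitive 1 alg ×
    (∀ (PA PB : Profile n) (M : Matching n) → Stable PA PB M →
      length (queries alg PA PB M) ≡ queryBound PA M)
theorem4 n =
  verify ,
  (λ PA PB M → Verification.checkAll-candidates-proves PA M PB) ,
  verify-competitive ,
  (λ PA PB M → Verification.length-checkAll-candidates PA M PB)
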